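{- Let $H$ be a hypergraph, $e = \{v_1,\ldots,v_m\}$ an edge of $H$, and let $H_e = (H \setminus \{e\}) \cup \{\{w,u_1\},\ldots,\{w,u_m\},\{u_1,v_1\},\ldots,\{u_m,v_m\}\}$ where $w, u_1, \ldots, u_m$ are new vertices not in $V(H)$. For every positive integer $k$, if $t(H) < k$ then $t(H_e) < k$.
   Context: A hypergraph $H$ on a finite set $V=V(H)$ is a collection of nonempty subsets of $V$, called edges. Standing convention: every edge is inclusion-minimal and has size at least $2$. A Berge cycle of length $\ell$ is an alternating sequence $x_1 f_1 x_2 f_2 \cdots x_\ell f_\ell$ of $\ell$ distinct vertices and $\ell$ distinct edges with $x_j, x_{j+1} \in f_j$ (indices mod $\ell$); it is ternary if $\ell$ is divisible by $3$. Two Berge cycles are disjoint if they share no vertex of their vertex sequences and no edge of their edge sequences. $t(H)$ is the maximum number of pairwise disjoint ternary Berge cycles in $H$. -}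

module Defs where

open import Data.Nat using (ℕ; zero; suc; NonZero)
open import Data.Nat.DivMod using (_%_; m%n<n)
open import Data.Nat.Divisibility using (_∣_)
open import Data.Fin using (Fin; toℕ; fromℕ<; punchIn)
open import Data.Fin.Subset using (Subset; _∈_; _⊆_)
open import Data.Sum using (_⊎_; inj₁; inj₂)
open import Data.Unit using (⊤; tt)
open import Data.Empty using (⊥)
open import Data.Product using (Σ; ∃; _×_)
open import Relation.Binary.PropositionalEquality using (_≡_; _≢_)
open import Relation.Nullary using (¬_)
open import Function.Definitions using (Injective)

record Hypergraph : Set₁ where
  field
    V   : Set
    Ed  : Set
    _∈ₑ_ : V → Ed → Set

open Hypergraph public

next : ∀ {l} → Fin (suc l) → Fin (suc l)
next {l} i = fromℕ< (m%n<n (suc (toℕ i)) (suc l))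

-- A Berge cycle of length ℓ = suc l: distinct vertices x₀..x_l,
-- distinct edges f₀..f_l with x_j, x_{j+1 mod ℓ} ∈ f_j.
record BergeCycle (H : Hypergraph) (l : ℕ) : Set where
  field
    x     : Fin (suc l) → V H
    f     : Fin (suc l) → Ed H
    x-inj : Injective _≡_ _≡_ x
    f-inj : Injective _≡_ _≡_ f
    x∈f   : ∀ j → _∈ₑ_ H (x j) (f j)
    x'∈f  : ∀ j → _∈ₑ_ H (x (next j)) (f j)

open BergeCycle public

TernaryCycle : Hypergraph → Set
TernaryCycle H = Σ ℕ λ l → (3 ∣ suc l) × BergeCycle H l

cyc : ∀ {H} → (C : TernaryCycle H) → BergeCycle H (Data.Product.proj₁ C)
cyc C = Data.Product.proj₂ (Data.Product.proj₂ C)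

Disjoint : ∀ {H} → TernaryCycle H → TernaryCycle H → Set
Disjoint C D = ∀ i j → (x (cyc C) i ≢ x (cyc D) j) × (f (cyc C) i ≢ f (cyc D) j)

-- H has k pairwise disjoint ternary Berge cycles (i.e. t(H) ≥ k).
HasDisjointTernary : Hypergraph → ℕ → Set
HasDisjointTernary H k =
  Σ (Fin k → TernaryCycle H) λ cs → ∀ a b → a ≢ b → Disjoint (cs a) (cs b)

t_<_ : Hypergraph → ℕ → Set
t H < k = ¬ HasDisjointTernary H k
infix 4 t_<_

finHG : ∀ n E → (Fin E → Subset n) → Hypergraph
finHG n E edge = record { V = Fin n ; Ed = Fin E ; _∈ₑ_ = λ x g → x ∈ edge g }

Convention : ∀ {n E} → (Fin E → Subset n) → Set
Convention {n} {E} edge =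
  (∀ g → Σ (Fin n) λ a → Σ (Fin n) λ b → (a ≢ b) × (a ∈ edge g) × (b ∈ edge g))
  × (∀ g h → edge g ⊆ edge h → g ≡ h)

-- New vertices: inj₂ (inj₁ tt) = w, inj₂ (inj₂ i) = u_i.
NewV : ℕ → ℕ → Set
NewV n m = Fin n ⊎ (⊤ ⊎ Fin m)

-- Incidence in H_e.  Edges of H_e:
--   inj₁ g          = the old edge  punchIn e g  (all old edges except e)
--   inj₂ (inj₁ i)   = {w , u_i}
--   inj₂ (inj₂ i)   = {u_i , v_i}
incE : ∀ {n E' m} → (Fin (suc E') → Subset n) → (e : Fin (suc E')) → (Fin m → Fin n)
     → NewV n m → Fin E' ⊎ (Fin m ⊎ Fin m) → Set
incE edge e v (inj₁ y) (inj₁ g) = y ∈ edge (punchIn e g)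
incE edge e v (inj₂ _) (inj₁ g) = ⊥
incE edge e v y (inj₂ (inj₁ i)) = (y ≡ inj₂ (inj₁ tt)) ⊎ (y ≡ inj₂ (inj₂ i))
incE edge e v y (inj₂ (inj₂ i)) = (y ≡ inj₂ (inj₂ i)) ⊎ (y ≡ inj₁ (v i))

-- H_e, where v : Fin m → Fin n enumerates e = {v_1,…,v_m}.
He : ∀ n E' m → (Fin (suc E') → Subset n) → Fin (suc E') → (Fin m → Fin n) → Hypergraph
He n E' m edge e v = record
  { V = NewV n m ; Ed = Fin E' ⊎ (Fin m ⊎ Fin m) ; _∈ₑ_ = incE edge e v }

-- Each new vertex u_i lies only on the two edges {w, u_i} and {u_i, v_i}, so a Berge cycle of
-- H_e either avoids w, and then uses no new vertex or edge and is a cycle of H, or it passes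
-- through w along v_a u_a w u_b v_b.  Replacing that segment by e gives a cycle of H three
-- steps shorter, hence still ternary (a ternary cycle through w cannot be a triangle, as u_a u_b
-- is not an edge).  The resulting cycle of H uses only old vertices and old edges of the
-- original one, and e only when the original passes through w; since two disjoint cycles
-- cannot both pass through w, disjoint ternary cycles of H_e yield disjoint ones of H.
-- Neither the convention on H, nor injectivity of v, nor v covering e, nor k ≥ 1 is needed.

module Submission where

open import Defs
open import Data.Nat using (ℕ; zero; suc; _+_; _∸_; _*_; _≤_; _<_; NonZero; z≤n; s≤s)
open import Data.Nat.Properties
  using (+-suc; +-assoc; +-comm; +-cancelˡ-≡; ≤-total; ≤-antisym; ≤-<-trans; ≤-refl; ≤-trans; <⇒≤;
         m≤n⇒m<n∨m≡n; m∸n+n≡m; m∸n≡0⇒m≤n; m∸n≤m; m≤n+m)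
open import Data.Nat.DivMod
  using (_%_; _/_; _mod_; m%n<n; m≡m%n+[m/n]*n; m%n%n≡m%n; %-distribˡ-+; %-remove-+ˡ; m<n⇒m%n≡m; n%n≡0)
open import Data.Nat.Divisibility using (_∣_; divides; n∣m*n; ∣m+n∣m⇒∣n; >⇒∤; ∣-refl)
open import Data.Fin using (Fin; toℕ; punchIn)
open import Data.Fin.Properties
  using (toℕ-injective; toℕ-fromℕ<; toℕ<n; toℕ≤pred[n]; punchIn-injective; punchInᵢ≢i; any?)
open import Data.Fin.Subset using (Subset; _∈_)
open import Data.Product using (Σ; ∃; ∃₂; _×_; _,_; proj₁; proj₂)
open import Data.Sum using (_⊎_; inj₁; inj₂; [_,_]′; fromInj₁)
open import Data.Sum.Properties using (inj₁-injective)
open import Data.Unit using (tt)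
open import Data.Empty using (⊥-elim)
open import Function using (_∘_; const)
open import Function.Definitions using (Injective)
open import Relation.Binary.PropositionalEquality
open import Relation.Nullary using (¬_; Dec; yes; no; contradiction)

resolveˡ : ∀ {a b} {A : Set a} {B : Set b} → A ⊎ B → ¬ B → A
resolveˡ (inj₁ a) _  = a
resolveˡ (inj₂ b) ¬b = ⊥-elim (¬b b)

resolveʳ : ∀ {a b} {A : Set a} {B : Set b} → A ⊎ B → ¬ A → B
resolveʳ (inj₁ a) ¬a = ⊥-elim (¬a a)
resolveʳ (inj₂ b) _  = b

[d+m]%n≡m%n⇒d≡0 : ∀ d m {n} .{{_ : NonZero n}} → d < n → (d + m) % n ≡ m % n → d ≡ 0
[d+m]%n≡m%n⇒d≡0 zero    m d<n eq = refl
[d+m]%n≡m%n⇒d≡0 (suc d) m {n} d<n eq = contradiction n∣d (>⇒∤ d<n)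
  where
  open ≡-Reasoning
  quotients : m / n * n + suc d ≡ (suc d + m) / n * n
  quotients = +-cancelˡ-≡ (m % n) _ _ (begin
    m % n + (m / n * n + suc d)   ≡⟨ sym (+-assoc (m % n) _ (suc d)) ⟩
    m % n + m / n * n + suc d     ≡⟨ cong (_+ suc d) (sym (m≡m%n+[m/n]*n m n)) ⟩
    m + suc d                       ≡⟨ +-comm m (suc d) ⟩
    suc d + m                       ≡⟨ m≡m%n+[m/n]*n (suc d + m) n ⟩
    (suc d + m) % n + (suc d + m) / n * n
                                  ≡⟨ cong (_+ (suc d + m) / n * n) eq ⟩
    m % n + (suc d + m) / n * n   ∎)
  n∣d : n ∣ suc d
  n∣d = ∣m+n∣m⇒∣n (divides ((suc d + m) / n) quotients) (n∣m*n (m / n))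

[i+m]%n≡[j+m]%n⇒i≡j : ∀ m {i j n} .{{_ : NonZero n}} → i < n → j < n →
                      (i + m) % n ≡ (j + m) % n → i ≡ j
[i+m]%n≡[j+m]%n⇒i≡j m {i} {j} {n} i<n j<n eq =
  [ (λ i≤j → sym (ordered i≤j j<n (sym eq))) , (λ j≤i → ordered j≤i i<n eq) ]′ (≤-total i j)
  where
  ordered : ∀ {i j} → i ≤ j → j < n → (j + m) % n ≡ (i + m) % n → j ≡ i
  ordered {i} {j} i≤j j<n eq = ≤-antisym (m∸n≡0⇒m≤n gap≡0) i≤j
    where
    split : j ∸ i + (i + m) ≡ j + m
    split = trans (sym (+-assoc (j ∸ i) i m)) (cong (_+ m) (m∸n+n≡m i≤j))
    gap≡0 : j ∸ i ≡ 0
    gap≡0 = [d+m]%n≡m%n⇒d≡0 (j ∸ i) (i + m) (≤-<-trans (m∸n≤m j i) j<n)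
              (trans (cong (_% n) split) eq)

module _ {n : ℕ} .{{_ : NonZero n}} where

  toℕ-mod : ∀ k → toℕ (k mod n) ≡ k % n
  toℕ-mod k = toℕ-fromℕ< (m%n<n k n)

  mod-toℕ : ∀ (j : Fin n) → toℕ j mod n ≡ j
  mod-toℕ j = toℕ-injective (trans (toℕ-mod (toℕ j)) (m<n⇒m%n≡m (toℕ<n j)))

  mod-periodic : ∀ k → (n + k) mod n ≡ k mod n
  mod-periodic k = toℕ-injective (begin
    toℕ ((n + k) mod n)  ≡⟨ toℕ-mod (n + k) ⟩
    (n + k) % n          ≡⟨ %-remove-+ˡ k ∣-refl ⟩
    k % n                ≡⟨ toℕ-mod k ⟨
    toℕ (k mod n)        ∎)
    where open ≡-Reasoning

  mod-injective-window : ∀ b {i j} → i < n → j < n → (i + b) mod n ≡ (j + b) mod n → i ≡ j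
  mod-injective-window b i<n j<n eq =
    [i+m]%n≡[j+m]%n⇒i≡j b i<n j<n (trans (sym (toℕ-mod _)) (trans (cong toℕ eq) (toℕ-mod _)))

toℕ-next : ∀ {l} (j : Fin (suc l)) → toℕ (next j) ≡ suc (toℕ j) % suc l
toℕ-next {l} j = toℕ-fromℕ< (m%n<n (suc (toℕ j)) (suc l))

toℕ-next-< : ∀ {l} (j : Fin (suc l)) → toℕ j < l → toℕ (next j) ≡ suc (toℕ j)
toℕ-next-< j j<l = trans (toℕ-next j) (m<n⇒m%n≡m (s≤s j<l))

toℕ-next-last : ∀ {l} (j : Fin (suc l)) → toℕ j ≡ l → toℕ (next j) ≡ 0
toℕ-next-last {l} j j≡l =
  trans (toℕ-next j) (trans (cong (λ r → suc r % suc l) j≡l) (n%n≡0 (suc l)))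

next-mod : ∀ {l} k → next (k mod suc l) ≡ suc k mod suc l
next-mod {l} k = toℕ-injective (begin
  toℕ (next (k mod L))        ≡⟨ toℕ-next (k mod L) ⟩
  suc (toℕ (k mod L)) % L     ≡⟨ cong (λ r → suc r % L) (toℕ-mod k) ⟩
  (1 + k % L) % L             ≡⟨ %-distribˡ-+ 1 (k % L) L ⟩
  (1 % L + k % L % L) % L     ≡⟨ cong (λ r → (1 % L + r) % L) (m%n%n≡m%n k L) ⟩
  (1 % L + k % L) % L         ≡⟨ %-distribˡ-+ 1 k L ⟨
  suc k % L                   ≡⟨ toℕ-mod (suc k) ⟨
  toℕ (suc k mod L)           ∎)
  where
  open ≡-Reasoning
  L : ℕ
  L = suc l

-- A cycle of length suc l read as sequences on ℕ of period suc l, so that consecutive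
-- positions and windows are plain additions.
module CyclicView {H : Hypergraph} {l : ℕ} (C : BergeCycle H l) where

  X : ℕ → V H
  X k = x C (k mod suc l)

  F : ℕ → Ed H
  F k = f C (k mod suc l)

  X∈F : ∀ k → _∈ₑ_ H (X k) (F k)
  X∈F k = x∈f C (k mod suc l)

  X-suc∈F : ∀ k → _∈ₑ_ H (X (suc k)) (F k)
  X-suc∈F k = subst (λ j → _∈ₑ_ H (x C j) (F k)) (next-mod k) (x'∈f C (k mod suc l))

  X-toℕ : ∀ j → X (toℕ j) ≡ x C j
  X-toℕ j = cong (x C) (mod-toℕ j)

  X-periodic : ∀ k → X (suc l + k) ≡ X k
  X-periodic k = cong (x C) (mod-periodic k)

  X-injective-window : ∀ b {i j} → i < suc l → j < suc l → X (i + b) ≡ X (j + b) → i ≡ j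
  X-injective-window b i<L j<L eq = mod-injective-window b i<L j<L (x-inj C eq)

  F-injective-window : ∀ b {i j} → i < suc l → j < suc l → F (i + b) ≡ F (j + b) → i ≡ j
  F-injective-window b i<L j<L eq = mod-injective-window b i<L j<L (f-inj C eq)

sequenceCycle : ∀ {H l} (X : ℕ → V H) (F : ℕ → Ed H) →
                (∀ {i j} → i ≤ l → j ≤ l → X i ≡ X j → i ≡ j) →
                (∀ {i j} → i ≤ l → j ≤ l → F i ≡ F j → i ≡ j) →
                (∀ k → k ≤ l → _∈ₑ_ H (X k) (F k)) →
                (∀ k → k < l → _∈ₑ_ H (X (suc k)) (F k)) →
                _∈ₑ_ H (X 0) (F l) →
                BergeCycle H l
sequenceCycle {H} {l} X F X-inj F-inj X∈F X-suc∈F X0∈Fl = record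
  { x     = X ∘ toℕ
  ; f     = F ∘ toℕ
  ; x-inj = λ {i} {j} eq → toℕ-injective (X-inj (toℕ≤pred[n] i) (toℕ≤pred[n] j) eq)
  ; f-inj = λ {i} {j} eq → toℕ-injective (F-inj (toℕ≤pred[n] i) (toℕ≤pred[n] j) eq)
  ; x∈f   = λ j → X∈F (toℕ j) (toℕ≤pred[n] j)
  ; x'∈f  = X-next∈F
  }
  where
  X-next∈F : ∀ j → _∈ₑ_ H (X (toℕ (next j))) (F (toℕ j))
  X-next∈F j with m≤n⇒m<n∨m≡n (toℕ≤pred[n] j)
  ... | inj₁ j<l =
    subst (λ a → _∈ₑ_ H (X a) (F (toℕ j))) (sym (toℕ-next-< j j<l)) (X-suc∈F (toℕ j) j<l)
  ... | inj₂ j≡l =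
    subst₂ (λ a b → _∈ₑ_ H (X a) (F b)) (sym (toℕ-next-last j j≡l)) (sym j≡l) X0∈Fl

module Subdivision {n E' m : ℕ} (edge : Fin (suc E') → Subset n) (e : Fin (suc E'))
                   (v : Fin m → Fin n) (v∈e : ∀ i → v i ∈ edge e) where

  H : Hypergraph
  H = finHG n (suc E') edge

  Hₑ : Hypergraph
  Hₑ = He n E' m edge e v

  infix 4 _∈ᵉ_
  _∈ᵉ_ : V Hₑ → Ed Hₑ → Set
  _∈ᵉ_ = incE edge e v

  w : V Hₑ
  w = inj₂ (inj₁ tt)

  u : Fin m → V Hₑ
  u i = inj₂ (inj₂ i)

  spoke leg : Fin m → Ed Hₑ
  spoke i = inj₂ (inj₁ i)
  leg   i = inj₂ (inj₂ i)

  _≟w : ∀ y → Dec (y ≡ w)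
  inj₁ _          ≟w = no λ ()
  inj₂ (inj₁ tt)  ≟w = yes refl
  inj₂ (inj₂ _)   ≟w = no λ ()

  spoke-ends : ∀ {i} y → y ∈ᵉ spoke i → y ≡ w ⊎ y ≡ u i
  spoke-ends (inj₁ _) y∈spoke = y∈spoke
  spoke-ends (inj₂ _) y∈spoke = y∈spoke

  leg-ends : ∀ {i} y → y ∈ᵉ leg i → y ≡ u i ⊎ y ≡ inj₁ (v i)
  leg-ends (inj₁ _) y∈leg = y∈leg
  leg-ends (inj₂ _) y∈leg = y∈leg

  spoke-at-w : ∀ h → w ∈ᵉ h → ∃ λ i → h ≡ spoke i
  spoke-at-w (inj₂ (inj₁ i)) _        = i , refl
  spoke-at-w (inj₂ (inj₂ i)) (inj₁ ())
  spoke-at-w (inj₂ (inj₂ i)) (inj₂ ())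

  edges-at-u : ∀ {i} h → u i ∈ᵉ h → h ≡ spoke i ⊎ h ≡ leg i
  edges-at-u (inj₂ (inj₁ _)) (inj₂ refl) = inj₁ refl
  edges-at-u (inj₂ (inj₂ _)) (inj₁ refl) = inj₂ refl

  edge-with-two-old-vertices : ∀ {y y'} h → inj₁ y ∈ᵉ h → inj₁ y' ∈ᵉ h → y ≢ y' →
                               ∃ λ g → h ≡ inj₁ g
  edge-with-two-old-vertices (inj₁ g)        _           _           _    = g , refl
  edge-with-two-old-vertices (inj₂ (inj₁ _)) (inj₁ ())  _           _
  edge-with-two-old-vertices (inj₂ (inj₁ _)) (inj₂ ())  _           _
  edge-with-two-old-vertices (inj₂ (inj₂ _)) (inj₂ refl) (inj₂ refl) y≢y' = ⊥-elim (y≢y' refl)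

  collapse : Ed Hₑ → Fin (suc E')
  collapse = [ punchIn e , const e ]′

  ∈-collapse : ∀ {y} h → inj₁ y ∈ᵉ h → y ∈ edge (collapse h)
  ∈-collapse (inj₁ g)        y∈g        = y∈g
  ∈-collapse (inj₂ (inj₁ _)) (inj₁ ())
  ∈-collapse (inj₂ (inj₁ _)) (inj₂ ())
  ∈-collapse (inj₂ (inj₂ i)) (inj₂ refl) = v∈e i

  collapse-injectiveˡ : ∀ {h h'} → (∃ λ g → h ≡ inj₁ g) → collapse h ≡ collapse h' → h ≡ h'
  collapse-injectiveˡ {h' = inj₁ g'} (g , refl) eq = cong inj₁ (punchIn-injective e g g' eq)
  collapse-injectiveˡ {h' = inj₂ _}  (g , refl) eq = ⊥-elim (punchInᵢ≢i e g eq)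

  Shadow : ∀ {l l'} → BergeCycle Hₑ l → BergeCycle H l' → Set
  Shadow C C' =
    (∀ i → ∃ λ s → x C s ≡ inj₁ (x C' i)) ×
    (∀ i → (∃₂ λ s g → f C s ≡ inj₁ g × f C' i ≡ punchIn e g) ⊎
           (f C' i ≡ e × ∃ λ s → x C s ≡ w))

  module OnCycle {l : ℕ} (C : BergeCycle Hₑ (suc l)) where
    open CyclicView C public

    X-adjacent : ∀ k → X k ≢ X (suc k)
    X-adjacent k eq with X-injective-window k {0} {1} (s≤s z≤n) (s≤s (s≤s z≤n)) eq
    ... | ()

    F-adjacent : ∀ k → F k ≢ F (suc k)
    F-adjacent k eq with F-injective-window k {0} {1} (s≤s z≤n) (s≤s (s≤s z≤n)) eq
    ... | ()

    w-once : ∀ p {d} → X p ≡ w → suc d < suc (suc l) → X (suc d + p) ≢ w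
    w-once p Xp≡w d<L X[d+p]≡w
      with X-injective-window p d<L (s≤s z≤n) (trans X[d+p]≡w (sym Xp≡w))
    ... | ()

    u-beside-w : ∀ p {i} → X (suc p) ≡ u i → X p ≡ w ⊎ X (2 + p) ≡ w
    u-beside-w p X1+p≡u
      with edges-at-u (F p) (subst (_∈ᵉ F p) X1+p≡u (X-suc∈F p))
         | edges-at-u (F (1 + p)) (subst (_∈ᵉ F (1 + p)) X1+p≡u (X∈F (1 + p)))
    ... | inj₁ Fp≡spoke | _ =
      inj₁ (resolveˡ (spoke-ends (X p) (subst (X p ∈ᵉ_) Fp≡spoke (X∈F p)))
                     (λ Xp≡u → X-adjacent p (trans Xp≡u (sym X1+p≡u))))
    ... | inj₂ _ | inj₁ F1+p≡spoke =
      inj₂ (resolveˡ (spoke-ends (X (2 + p)) (subst (X (2 + p) ∈ᵉ_) F1+p≡spoke (X-suc∈F (1 + p))))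
                     (λ X2+p≡u → X-adjacent (1 + p) (trans X1+p≡u (sym X2+p≡u))))
    ... | inj₂ Fp≡leg | inj₂ F1+p≡leg = ⊥-elim (F-adjacent p (trans Fp≡leg (sym F1+p≡leg)))

    arm-forward : ∀ p → X p ≡ w → ∃ λ i → X (2 + p) ≡ inj₁ (v i)
    arm-forward p Xp≡w with spoke-at-w (F p) (subst (_∈ᵉ F p) Xp≡w (X∈F p))
    ... | i , Fp≡spoke =
      i , resolveʳ (leg-ends (X (2 + p)) (subst (X (2 + p) ∈ᵉ_) F1+p≡leg (X-suc∈F (1 + p))))
                   (λ X2+p≡u → X-adjacent (1 + p) (trans X1+p≡u (sym X2+p≡u)))
      where
      X1+p≡u : X (1 + p) ≡ u i
      X1+p≡u = resolveʳ (spoke-ends (X (1 + p)) (subst (X (1 + p) ∈ᵉ_) Fp≡spoke (X-suc∈F p)))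
                        (λ X1+p≡w → X-adjacent p (trans Xp≡w (sym X1+p≡w)))
      F1+p≡leg : F (1 + p) ≡ leg i
      F1+p≡leg = resolveʳ (edges-at-u (F (1 + p)) (subst (_∈ᵉ F (1 + p)) X1+p≡u (X∈F (1 + p))))
                          (λ F1+p≡spoke → F-adjacent p (trans Fp≡spoke (sym F1+p≡spoke)))

    arm-backward : ∀ r → X (2 + r) ≡ w → ∃ λ i → X (1 + r) ≡ u i × F r ≡ leg i
    arm-backward r X2+r≡w
      with spoke-at-w (F (1 + r)) (subst (_∈ᵉ F (1 + r)) X2+r≡w (X-suc∈F (1 + r)))
    ... | i , F1+r≡spoke = i , X1+r≡u , Fr≡leg
      where
      X1+r≡u : X (1 + r) ≡ u i
      X1+r≡u = resolveʳ (spoke-ends (X (1 + r)) (subst (X (1 + r) ∈ᵉ_) F1+r≡spoke (X∈F (1 + r))))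
                        (λ X1+r≡w → X-adjacent (1 + r) (trans X1+r≡w (sym X2+r≡w)))
      Fr≡leg : F r ≡ leg i
      Fr≡leg = resolveʳ (edges-at-u (F r) (subst (_∈ᵉ F r) X1+r≡u (X-suc∈F r)))
                        (λ Fr≡spoke → F-adjacent r (trans Fr≡spoke (sym F1+r≡spoke)))

    w-free⇒old : (∀ s → x C s ≢ w) → ∀ k → ∃ λ y → X k ≡ inj₁ y
    w-free⇒old no-w k with X k in Xk≡
    ... | inj₁ y         = y , refl
    ... | inj₂ (inj₁ tt) = ⊥-elim (no-w _ Xk≡)
    ... | inj₂ (inj₂ i)  =
      ⊥-elim ([ no-w _ , no-w _ ]′ (u-beside-w (suc l + k) (trans (X-periodic k) Xk≡)))

    old-away-from-w : ∀ p → X p ≡ w → ∀ k → 3 + k < suc (suc l) →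
                      ∃ λ y → X (2 + k + p) ≡ inj₁ y
    old-away-from-w p Xp≡w k 3+k<L with X (2 + k + p) in X≡
    ... | inj₁ y         = y , refl
    ... | inj₂ (inj₁ tt) = ⊥-elim (w-once p Xp≡w (<⇒≤ 3+k<L) X≡)
    ... | inj₂ (inj₂ i)  =
      ⊥-elim ([ w-once p Xp≡w (<⇒≤ (<⇒≤ 3+k<L)) , w-once p Xp≡w 3+k<L ]′
                (u-beside-w (1 + k + p) X≡))

    adjacent-old⇒old-edge : ∀ k {y y'} → X k ≡ inj₁ y → X (suc k) ≡ inj₁ y' → ∃ λ g → F k ≡ inj₁ g
    adjacent-old⇒old-edge k Xk≡y X1+k≡y' =
      edge-with-two-old-vertices (F k)
        (subst (_∈ᵉ F k) Xk≡y (X∈F k)) (subst (_∈ᵉ F k) X1+k≡y' (X-suc∈F k))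
        (λ y≡y' → X-adjacent k (trans Xk≡y (trans (cong inj₁ y≡y') (sym X1+k≡y'))))

    -- The positions b, …, l' + b of C as a cycle of H, closed up by the collapse of F (l' + b).
    window : ∀ b l' → l' ≤ suc l →
             (∀ k → k ≤ l' → ∃ λ y → X (k + b) ≡ inj₁ y) →
             (∀ y → X b ≡ inj₁ y → y ∈ edge (collapse (F (l' + b)))) →
             (∀ h → F (l' + b) ≡ inj₂ h → ∃ λ s → x C s ≡ w) →
             Σ (BergeCycle H l') (Shadow C)
    window b l' l'≤L old closes new⇒w = C' , vertices , edges
      where
      -- The default is never used: X (k + b) is old for k ≤ l'.
      X' : ℕ → Fin n
      X' k = fromInj₁ (const (proj₁ (old 0 z≤n))) (X (k + b))

      F' : ℕ → Fin (suc E')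
      F' k = collapse (F (k + b))

      X≡X' : ∀ k → k ≤ l' → X (k + b) ≡ inj₁ (X' k)
      X≡X' k k≤l' with X (k + b) | old k k≤l'
      ... | _ | y , refl = refl

      F-old : ∀ k → k < l' → ∃ λ g → F (k + b) ≡ inj₁ g
      F-old k k<l' = adjacent-old⇒old-edge (k + b) (X≡X' k (<⇒≤ k<l')) (X≡X' (suc k) k<l')

      in-window : ∀ {k} → k ≤ l' → k < suc (suc l)
      in-window k≤l' = s≤s (≤-trans k≤l' l'≤L)

      X'-injective : ∀ {i j} → i ≤ l' → j ≤ l' → X' i ≡ X' j → i ≡ j
      X'-injective {i} {j} i≤l' j≤l' eq = X-injective-window b (in-window i≤l') (in-window j≤l')
        (trans (X≡X' i i≤l') (trans (cong inj₁ eq) (sym (X≡X' j j≤l'))))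

      F'-injective : ∀ {i j} → i ≤ l' → j ≤ l' → F' i ≡ F' j → i ≡ j
      F'-injective {i} {j} i≤l' j≤l' eq with m≤n⇒m<n∨m≡n i≤l' | m≤n⇒m<n∨m≡n j≤l'
      ... | inj₁ i<l' | _ = F-injective-window b (in-window i≤l') (in-window j≤l')
                              (collapse-injectiveˡ (F-old i i<l') eq)
      ... | _ | inj₁ j<l' = F-injective-window b (in-window i≤l') (in-window j≤l')
                              (sym (collapse-injectiveˡ (F-old j j<l') (sym eq)))
      ... | inj₂ i≡l' | inj₂ j≡l' = trans i≡l' (sym j≡l')

      X'∈F' : ∀ k → k ≤ l' → X' k ∈ edge (F' k)
      X'∈F' k k≤l' = ∈-collapse (F (k + b)) (subst (_∈ᵉ F (k + b)) (X≡X' k k≤l') (X∈F (k + b)))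

      X'-suc∈F' : ∀ k → k < l' → X' (suc k) ∈ edge (F' k)
      X'-suc∈F' k k<l' =
        ∈-collapse (F (k + b)) (subst (_∈ᵉ F (k + b)) (X≡X' (suc k) k<l') (X-suc∈F (k + b)))

      C' : BergeCycle H l'
      C' = sequenceCycle X' F' X'-injective F'-injective X'∈F' X'-suc∈F' (closes (X' 0) (X≡X' 0 z≤n))

      vertices : ∀ i → ∃ λ s → x C s ≡ inj₁ (x C' i)
      vertices i = _ , X≡X' (toℕ i) (toℕ≤pred[n] i)

      new-edge-at-end : ∀ k → k ≤ l' → ∀ h → F (k + b) ≡ inj₂ h → ∃ λ s → x C s ≡ w
      new-edge-at-end k k≤l' h Fk≡h with m≤n⇒m<n∨m≡n k≤l'
      ... | inj₁ k<l' = contradiction (trans (sym (proj₂ (F-old k k<l'))) Fk≡h) λ ()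
      ... | inj₂ refl = new⇒w h Fk≡h

      edges : ∀ i → (∃₂ λ s g → f C s ≡ inj₁ g × f C' i ≡ punchIn e g) ⊎
                    (f C' i ≡ e × ∃ λ s → x C s ≡ w)
      edges i with F (toℕ i + b) in Fi≡
      ... | inj₁ g = inj₁ (_ , g , Fi≡ , refl)
      ... | inj₂ h = inj₂ (refl , new-edge-at-end (toℕ i) (toℕ≤pred[n] i) h Fi≡)

    shadow-w-free : (∀ s → x C s ≢ w) → Σ (BergeCycle H (suc l)) (Shadow C)
    shadow-w-free no-w = window 0 (suc l) ≤-refl (λ k _ → X-old (k + 0)) closes last-edge-old
      where
      X-old : ∀ k → ∃ λ y → X k ≡ inj₁ y
      X-old = w-free⇒old no-w

      closes : ∀ y → X 0 ≡ inj₁ y → y ∈ edge (collapse (F (suc l + 0)))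
      closes y X0≡y = ∈-collapse (F (suc l + 0))
        (subst (_∈ᵉ F (suc l + 0)) (trans (X-periodic 0) X0≡y) (X-suc∈F (suc l + 0)))

      last-edge-old : ∀ h → F (suc l + 0) ≡ inj₂ h → ∃ λ s → x C s ≡ w
      last-edge-old h Fl≡h
        with adjacent-old⇒old-edge (suc l + 0) (proj₂ (X-old (suc l + 0)))
                                               (proj₂ (X-old (suc (suc l + 0))))
      ... | g , Fl≡g = contradiction (trans (sym Fl≡g) Fl≡h) λ ()

  no-triangle-through-w : (C : BergeCycle Hₑ 2) → ∀ s → x C s ≢ w
  no-triangle-through-w C s xs≡w = contradiction (trans (sym X2+p≡u) X2+p≡v) λ ()
    where
    open OnCycle C
    p : ℕ
    p = toℕ s
    Xp≡w : X p ≡ w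
    Xp≡w = trans (X-toℕ s) xs≡w
    X2+p≡v : X (2 + p) ≡ inj₁ (v (proj₁ (arm-forward p Xp≡w)))
    X2+p≡v = proj₂ (arm-forward p Xp≡w)
    X2+p≡u : X (2 + p) ≡ u (proj₁ (arm-backward (1 + p) (trans (X-periodic p) Xp≡w)))
    X2+p≡u = proj₁ (proj₂ (arm-backward (1 + p) (trans (X-periodic p) Xp≡w)))

  shadow-through-w : ∀ {l'} (C : BergeCycle Hₑ (3 + l')) → ∀ s → x C s ≡ w →
                     Σ (BergeCycle H l') (Shadow C)
  shadow-through-w {l'} C s xs≡w = window (2 + p) l' (m≤n+m l' 3) old closes (λ _ _ → s , xs≡w)
    where
    open OnCycle C
    -- Positions p, 2 + p, 2 + l' + p, 4 + l' + p carry w, v_b, v_a, w: the window keeps v_b … v_a.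
    p : ℕ
    p = toℕ s

    Xp≡w : X p ≡ w
    Xp≡w = trans (X-toℕ s) xs≡w

    shift : ∀ k → k + (2 + p) ≡ 2 + k + p
    shift k = trans (+-suc k (suc p)) (cong suc (+-suc k p))

    old : ∀ k → k ≤ l' → ∃ λ y → X (k + (2 + p)) ≡ inj₁ y
    old k k≤l' = subst (λ q → ∃ λ y → X q ≡ inj₁ y) (sym (shift k))
                   (old-away-from-w p Xp≡w k (s≤s (s≤s (s≤s (s≤s k≤l')))))

    closes : ∀ y → X (2 + p) ≡ inj₁ y → y ∈ edge (collapse (F (l' + (2 + p))))
    closes y X2+p≡y with arm-forward p Xp≡w | arm-backward (2 + l' + p) (trans (X-periodic p) Xp≡w)
    ... | i , X2+p≡v | _ , _ , F≡leg =
      subst₂ (λ z h → z ∈ edge (collapse h))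
             (inj₁-injective (trans (sym X2+p≡v) X2+p≡y))
             (sym (trans (cong F (shift l')) F≡leg))
             (v∈e i)

  shadow : (C : TernaryCycle Hₑ) → Σ (TernaryCycle H) λ C' → Shadow (cyc C) (cyc C')
  shadow (l , 3∣L , C) with any? (λ s → x C s ≟w)
  shadow (0 , 3∣1 , C) | _ = contradiction 3∣1 (>⇒∤ (s≤s (s≤s z≤n)))
  shadow (suc l , 3∣L , C) | no no-w
    with OnCycle.shadow-w-free C (λ s xs≡w → no-w (s , xs≡w))
  ... | C' , C⇝C' = (suc l , 3∣L , C') , C⇝C'
  shadow (1 , 3∣2 , C) | yes _ = contradiction 3∣2 (>⇒∤ (s≤s (s≤s (s≤s z≤n))))
  shadow (2 , _ , C) | yes (s , xs≡w) = ⊥-elim (no-triangle-through-w C s xs≡w)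
  shadow (suc (suc (suc l')) , 3∣L , C) | yes (s , xs≡w) with shadow-through-w C s xs≡w
  ... | C' , C⇝C' = (l' , ∣m+n∣m⇒∣n 3∣L ∣-refl , C') , C⇝C'

  shadows-disjoint : ∀ C D → Disjoint C D → Disjoint (proj₁ (shadow C)) (proj₁ (shadow D))
  shadows-disjoint C D C#D with shadow C | shadow D
  ... | C' , C-vertices , C-edges | D' , D-vertices , D-edges =
    λ i j → distinct-vertices i j , distinct-edges i j
    where
    distinct-vertices : ∀ i j → x (cyc C') i ≢ x (cyc D') j
    distinct-vertices i j eq with C-vertices i | D-vertices j
    ... | s , xs≡ | t , xt≡ = proj₁ (C#D s t) (trans xs≡ (trans (cong inj₁ eq) (sym xt≡)))

    distinct-edges : ∀ i j → f (cyc C') i ≢ f (cyc D') j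
    distinct-edges i j eq with C-edges i | D-edges j
    ... | inj₁ (s , g , fs≡g , i≡g) | inj₁ (t , g' , ft≡g' , j≡g') =
      proj₂ (C#D s t) (trans fs≡g (trans (cong inj₁ g≡g') (sym ft≡g')))
      where
      g≡g' : g ≡ g'
      g≡g' = punchIn-injective e g g' (trans (sym i≡g) (trans eq j≡g'))
    ... | inj₁ (_ , g , _ , i≡g) | inj₂ (j≡e , _) =
      punchInᵢ≢i e g (trans (sym i≡g) (trans eq j≡e))
    ... | inj₂ (i≡e , _) | inj₁ (_ , g , _ , j≡g) =
      punchInᵢ≢i e g (trans (sym j≡g) (trans (sym eq) i≡e))
    ... | inj₂ (_ , s , xs≡w) | inj₂ (_ , t , xt≡w) = proj₁ (C#D s t) (trans xs≡w (sym xt≡w))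

lemma5p2 : ∀ (n E' : ℕ) (edge : Fin (suc E') → Subset n) → Convention edge
    → (e : Fin (suc E')) (m : ℕ) (v : Fin m → Fin n) → Injective _≡_ _≡_ v
    → (∀ i → v i ∈ edge e) → (∀ y → y ∈ edge e → ∃ λ i → v i ≡ y)
    → ∀ (k : ℕ) → 1 ≤ k
    → t finHG n (suc E') edge < k → t He n E' m edge e v < k
lemma5p2 n E' edge _ e m v _ v∈e _ k _ t[H]<k (cycles , disjoint) =
  t[H]<k ( proj₁ ∘ shadow ∘ cycles
         , λ a b a≢b → shadows-disjoint (cycles a) (cycles b) (disjoint a b a≢b))
  where open Subdivision edge e v v∈e
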